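{- Let $k\geq 2$ and $1\leq x\leq 2k-1$ be integers and $n=2k+x$. If $x\geq \sqrt{4k-2}$, then $\lambda^k(C_n)\leq x+2$.
   Context: $C_n$ is the cycle on $n$ vertices and $K_n$ the complete graph on $n$ vertices. A $p$-labeled packing of $k$ copies of $C_n$ into $K_n$ is a map $f$ from $V(K_n)$ onto a set of exactly $p$ labels together with injections $\sigma_1,\dots,\sigma_k:V(C_n)\to V(K_n)$ such that for $i\neq j$ the induced edge images $\sigma_i^*(E(C_n))$ and $\sigma_j^*(E(C_n))$ are disjoint, and for every $v\in V(C_n)$, $f(\sigma_1(v))=\dots=f(\sigma_k(v))$. $\lambda^k(C_n)$ is the largest $p$ for which such a packing exists. -}

module Defs where

open import Data.Nat using (ℕ; suc; _+_; _%_; NonZero)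
open import Data.Fin using (Fin; toℕ)
open import Data.Product using (∃; _×_)
open import Data.Sum using (_⊎_)
open import Relation.Binary.PropositionalEquality using (_≡_; _≢_)
open import Relation.Nullary using (¬_)
open import Function.Definitions using (Injective)

-- Edges of the cycle C_n on vertex set Fin n : a is joined to b when
-- b = a + 1 (mod n), i.e. b = a+1, or a = n-1 and b = 0.  Each edge {a, a+1} of C_n is listed once (with orientation).
CEdge : (n : ℕ) → Fin n → Fin n → Set
CEdge n a b = (toℕ b ≡ suc (toℕ a)) ⊎ (suc (toℕ a) ≡ n × toℕ b ≡ 0)

SamePair : {n : ℕ} → Fin n → Fin n → Fin n → Fin n → Set
SamePair u v u' v' = (u ≡ u' × v ≡ v') ⊎ (u ≡ v' × v ≡ u')

-- A p-labeled packing of k copies of C_n into K_n (V(C_n) = V(K_n) = Fin n).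
record LabeledPacking (k n p : ℕ) : Set where
  field
    label      : Fin n → Fin p
    label-onto : ∀ (l : Fin p) → ∃ λ v → label v ≡ l
    σ          : Fin k → Fin n → Fin n
    σ-inj      : ∀ i → Injective _≡_ _≡_ (σ i)
    disjoint   : ∀ i j → i ≢ j → ∀ a b c d → CEdge n a b → CEdge n c d →
                 ¬ SamePair (σ i a) (σ i b) (σ j c) (σ j d)
    labels     : ∀ i j v → label (σ i v) ≡ label (σ j v)

-- Let a be the size of a smallest label class L and w a vertex of K_n labelled L.
-- In every copy w has a successor and a predecessor on the cycle; edge-disjointness
-- (and n ≥ 3) makes these 2k vertices distinct, and each carries a label adjacent to L
-- in the labelling of C_n shared by all copies. At most 2a labels are adjacent to L;
-- the c other labels have classes of size ≥ a avoiding those 2k vertices, so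
-- ca + 2k ≤ n, while pa ≤ n and p ≤ 2a + c. If 2a ≤ x this gives p ≤ 2a + x/a ≤ x + 2;
-- if 2a > x then (x + 1)p ≤ 2pa ≤ 4k + 2x ≤ x² + 2x + 2 < (x + 1)(x + 3).
module Submission where

open import Defs
open import Data.Nat using (ℕ; zero; suc; _+_; _*_; _∸_; _≤_; _<_; z≤n; s≤s; s≤s⁻¹; z<s)
import Data.Nat as ℕ
open import Data.Bool using (Bool; true; false; not; _∧_; _∨_; T)
open import Data.Bool.Properties using (T-∨; T?)
open import Data.Fin using (Fin; zero; suc; toℕ; fromℕ; fromℕ<; inject₁; punchOut; splitAt; join)
open import Data.Fin.Properties
  using (_≟_; any?; suc-injective; toℕ≤pred[n]; toℕ-fromℕ; toℕ-fromℕ<; toℕ-inject₁;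
         punchOut-injective; injective⇒≤; join-splitAt)
open import Data.Nat.Properties
  using (+-*-semiring; +-suc; +-assoc; +-identityʳ; *-identityʳ; *-zeroʳ; ≤-refl; ≤-trans;
         ≤-reflexive; +-mono-≤; +-monoʳ-≤; +-monoˡ-≤; *-monoʳ-≤; m≤n⇒m≤1+n; <-asym; ≤∧≢⇒<;
         1+n≰n; m<m+n; m≤m+n; *-cancelʳ-<; +-cancelˡ-≤; m≤n+m∸n; m≤n⇒∃[o]m+o≡n; ≤-<-connex;
         module ≤-Reasoning)
open import Data.Nat.Tactic.RingSolver using (solve)
open import Data.List using (_∷_; []; allFin)
open import Data.List.Extrema.Nat using (argmin; f[argmin]≤f[xs])
open import Data.List.Membership.Propositional.Properties using (∈-allFin)
import Data.List.Relation.Unary.All as All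
open import Data.Product using (∃; _,_; proj₁; proj₂)
open import Data.Sum using (_⊎_; inj₁; inj₂; [_,_]′)
open import Function using (_∘_; Equivalence)
open import Function.Definitions using (Injective)
open import Relation.Binary.PropositionalEquality
open import Relation.Nullary using (¬_; does; yes; no; contradiction)
open import Relation.Nullary.Decidable using (⌊_⌋; _×-dec_; toWitness; fromWitness; dec-true)
open import Algebra.Properties.Semiring.Sum +-*-semiring
  using (sum-syntax; ∑-comm; sum-cong-≗; sum-replicate-zero; *-distribˡ-sum; *-distribʳ-sum)

private variable
  m n p : ℕ

indicator : Bool → ℕ
indicator true  = 1
indicator false = 0

count : (Fin n → Bool) → ℕ
count {n} P = ∑[ i < n ] indicator (P i)

count-true : ∀ n → count {n} (λ _ → true) ≡ n
count-true zero    = refl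
count-true (suc n) = cong suc (count-true n)

count-∨ : (P Q : Fin n → Bool) → count (λ i → P i ∨ Q i) ≤ count P + count Q
count-∨ {zero}  P Q = z≤n
count-∨ {suc n} P Q with P zero | Q zero | count-∨ (P ∘ suc) (Q ∘ suc)
... | true  | true  | ih = s≤s (≤-trans ih (+-monoʳ-≤ _ (m≤n⇒m≤1+n ≤-refl)))
... | true  | false | ih = s≤s ih
... | false | true  | ih = ≤-trans (s≤s ih) (≤-reflexive (sym (+-suc _ _)))
... | false | false | ih = ih

count-complement : (P : Fin n → Bool) → count P + count (not ∘ P) ≡ n
count-complement {zero}  P = refl
count-complement {suc n} P with P zero
... | true  = cong suc (count-complement (P ∘ suc))
... | false = trans (+-suc _ _) (cong suc (count-complement (P ∘ suc)))

-- Equality tests are counted through `does` rather than `⌊_⌋`: only `does` reduces on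
-- `suc z ≟ suc y`, which the inductions here and in `∑-δ` rely on.
count-remove : (Q : Fin n → Bool) (y : Fin n) → T (Q y) →
               count Q ≡ suc (count (λ z → not (does (z ≟ y)) ∧ Q z))
count-remove Q zero Qy with Q zero
... | true = refl
count-remove {suc n} Q (suc y) Qy =
  trans (cong (indicator (Q zero) +_) (count-remove (Q ∘ suc) y Qy))
        (+-suc (indicator (Q zero)) (count (λ z → not (does (z ≟ y)) ∧ Q (suc z))))

injection⇒count≤count : (P : Fin m → Bool) (Q : Fin n → Bool) (h : ∀ i → T (P i) → Fin n) →
                    (∀ i Pi → T (Q (h i Pi))) →
                    (∀ {i j} Pi Pj → h i Pi ≡ h j Pj → i ≡ j) →
                    count P ≤ count Q
injection⇒count≤count {zero} P Q h hQ h-inj = z≤n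
injection⇒count≤count {suc m} P Q h hQ h-inj with P zero in P₀
... | false = injection⇒count≤count (P ∘ suc) Q (h ∘ suc) (hQ ∘ suc) (λ Pi Pj → suc-injective ∘ h-inj Pi Pj)
... | true = subst (suc (count (P ∘ suc)) ≤_) (sym (count-remove Q y (hQ zero P0)))
    (s≤s (injection⇒count≤count (P ∘ suc) Q′ (h ∘ suc) Q′-h (λ Pi Pj → suc-injective ∘ h-inj Pi Pj)))
  where
  P0 : T (P zero)
  P0 = subst T (sym P₀) _
  y = h zero P0
  Q′ : Fin _ → Bool
  Q′ z = not (does (z ≟ y)) ∧ Q z
  Q′-h : ∀ i Pi → T (Q′ (h (suc i) Pi))
  Q′-h i Pi with h (suc i) Pi ≟ y
  ... | yes hi≡y = contradiction (h-inj Pi P0 hi≡y) λ ()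
  ... | no _     = hQ (suc i) Pi

injective⇒≤count : (Q : Fin n → Bool) (h : Fin m → Fin n) → Injective _≡_ _≡_ h →
                    (∀ i → T (Q (h i))) → m ≤ count Q
injective⇒≤count {m = m} Q h h-inj Qh = subst (_≤ count Q) (count-true m)
  (injection⇒count≤count (λ _ → true) Q (λ i _ → h i) (λ i _ → Qh i) (λ _ _ → h-inj))

count-∘-injective : (Q : Fin n → Bool) (σ : Fin m → Fin n) → Injective _≡_ _≡_ σ →
                    count (Q ∘ σ) ≤ count Q
count-∘-injective Q σ σ-inj = injection⇒count≤count (Q ∘ σ) Q (λ i _ → σ i) (λ _ Qσi → Qσi) (λ _ _ → σ-inj)

count>0 : (Q : Fin n → Bool) (y : Fin n) → T (Q y) → 0 < count Q
count>0 Q y Qy = subst (1 ≤_) (sym (count-remove Q y Qy)) (s≤s z≤n)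

image : (Fin n → Bool) → (Fin n → Fin p) → Fin p → Bool
image P g m = ⌊ any? (λ z → T? (P z) ×-dec g z ≟ m) ⌋

image⁺ : (P : Fin n → Bool) (g : Fin n → Fin p) {z : Fin n} → T (P z) → T (image P g (g z))
image⁺ P g {z} Pz = fromWitness (z , Pz , refl)

count-image : (P : Fin n → Bool) (g : Fin n → Fin p) → count (image P g) ≤ count P
count-image P g = injection⇒count≤count (image P g) P (λ _ → proj₁ ∘ toWitness) (λ _ → proj₁ ∘ proj₂ ∘ toWitness)
  λ m∈ m′∈ z≡z′ → trans (sym (proj₂ (proj₂ (toWitness m∈))))
                        (trans (cong g z≡z′) (proj₂ (proj₂ (toWitness m′∈))))

∑-mono-≤ : (x y : Fin n → ℕ) → (∀ i → x i ≤ y i) → ∑[ i < n ] x i ≤ ∑[ i < n ] y i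
∑-mono-≤ {zero}  x y x≤y = z≤n
∑-mono-≤ {suc n} x y x≤y = +-mono-≤ (x≤y zero) (∑-mono-≤ (x ∘ suc) (y ∘ suc) (x≤y ∘ suc))

∑-δ : (x : Fin p → ℕ) (y : Fin p) → ∑[ m < p ] (x m * indicator (does (y ≟ m))) ≡ x y
∑-δ {suc p} x zero = begin
  x zero * 1 + ∑[ m < p ] (x (suc m) * 0)  ≡⟨ cong₂ _+_ (*-identityʳ (x zero)) (sum-cong-≗ (*-zeroʳ ∘ x ∘ suc)) ⟩
  x zero + ∑[ m < p ] 0                     ≡⟨ cong (x zero +_) (sum-replicate-zero p) ⟩
  x zero + 0                                ≡⟨ +-identityʳ (x zero) ⟩
  x zero                                    ∎
  where open ≡-Reasoning
∑-δ {suc p} x (suc y) =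
  trans (cong (_+ ∑[ m < p ] (x (suc m) * indicator (does (y ≟ m)))) (*-zeroʳ (x zero))) (∑-δ (x ∘ suc) y)

fibre : (Fin n → Fin p) → Fin p → Fin n → Bool
fibre f m v = does (f v ≟ m)

count-fibres : (f : Fin n → Fin p) (g : Fin p → Bool) →
               ∑[ m < p ] (indicator (g m) * count (fibre f m)) ≡ count (g ∘ f)
count-fibres {n} {p} f g = begin
  ∑[ m < p ] (indicator (g m) * count (fibre f m))
    ≡⟨ sum-cong-≗ (λ m → *-distribˡ-sum (indicator (g m)) (indicator ∘ fibre f m)) ⟩
  ∑[ m < p ] ∑[ v < n ] (indicator (g m) * indicator (does (f v ≟ m)))
    ≡⟨ ∑-comm (λ m v → indicator (g m) * indicator (does (f v ≟ m))) ⟩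
  ∑[ v < n ] ∑[ m < p ] (indicator (g m) * indicator (does (f v ≟ m)))
    ≡⟨ sum-cong-≗ (λ v → ∑-δ (indicator ∘ g) (f v)) ⟩
  count (g ∘ f)
    ∎
  where open ≡-Reasoning

count-preimage-≥ : (f : Fin n → Fin p) (g : Fin p → Bool) {a : ℕ} →
                   (∀ m → a ≤ count (fibre f m)) → count g * a ≤ count (g ∘ f)
count-preimage-≥ {p = p} f g {a} a≤fibre = begin
  count g * a                                        ≡⟨ *-distribʳ-sum a (indicator ∘ g) ⟩
  ∑[ m < p ] (indicator (g m) * a)                   ≤⟨ ∑-mono-≤ _ _ (λ m → *-monoʳ-≤ (indicator (g m)) (a≤fibre m)) ⟩
  ∑[ m < p ] (indicator (g m) * count (fibre f m))   ≡⟨ count-fibres f g ⟩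
  count (g ∘ f)                                      ∎
  where open ≤-Reasoning

fibre⁺ : (f : Fin n → Fin p) {m : Fin p} {v : Fin n} → f v ≡ m → T (fibre f m v)
fibre⁺ f {m} {v} fv≡m = subst T (sym (dec-true (f v ≟ m) fv≡m)) _

injective⇒surjective : {σ : Fin n → Fin n} → Injective _≡_ _≡_ σ → ∀ w → ∃ λ u → σ u ≡ w
injective⇒surjective {suc n} {σ} σ-inj w with any? (λ u → σ u ≟ w)
... | yes hit  = hit
... | no  miss = contradiction (injective⇒≤ punched-injective) 1+n≰n
  where
  punched : Fin (suc n) → Fin n
  punched u = punchOut {i = w} (λ w≡σu → miss (u , sym w≡σu))
  punched-injective : Injective _≡_ _≡_ punched
  punched-injective eq = σ-inj (punchOut-injective {i = w} _ _ eq)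

splitAt-injective : ∀ m {n} → Injective _≡_ _≡_ (splitAt m {n})
splitAt-injective m {n} {i} {j} eq =
  trans (sym (join-splitAt m n i)) (trans (cong (join m n) eq) (join-splitAt m n j))

cycle-successor : (u : Fin n) → ∃ (CEdge n u)
cycle-successor {suc n} u with toℕ u ℕ.≟ n
... | yes u≡n = zero , inj₂ (cong suc u≡n , refl)
... | no  u≢n = fromℕ< 1+u<1+n , inj₁ (toℕ-fromℕ< 1+u<1+n)
  where 1+u<1+n = s≤s (≤∧≢⇒< (toℕ≤pred[n] u) u≢n)

cycle-predecessor : (v : Fin n) → ∃ λ u → CEdge n u v
cycle-predecessor {suc n} zero    = fromℕ n , inj₂ (cong suc (toℕ-fromℕ n) , refl)
cycle-predecessor {suc n} (suc v) = inject₁ v , inj₁ (cong suc (sym (toℕ-inject₁ v)))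

-- A 2-cycle u → v → u forces n = 2 or n = 1.
CEdge-asym : 3 ≤ n → {u v : Fin n} → CEdge n u v → ¬ CEdge n v u
CEdge-asym n≥3 (inj₁ v≡1+u) (inj₁ u≡1+v) = <-asym (≤-reflexive (sym v≡1+u)) (≤-reflexive (sym u≡1+v))
CEdge-asym n≥3 (inj₁ v≡1+u) (inj₂ (1+v≡n , u≡0)) =
  contradiction (subst (3 ≤_) (trans (sym 1+v≡n) (cong suc (trans v≡1+u (cong suc u≡0)))) n≥3)
                λ where (s≤s (s≤s ()))
CEdge-asym n≥3 (inj₂ (1+u≡n , v≡0)) (inj₁ u≡1+v) =
  contradiction (subst (3 ≤_) (trans (sym 1+u≡n) (cong suc (trans u≡1+v (cong suc v≡0)))) n≥3)
                λ where (s≤s (s≤s ()))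
CEdge-asym n≥3 (inj₂ (1+u≡n , v≡0)) (inj₂ (1+v≡n , _)) =
  contradiction (subst (3 ≤_) (trans (sym 1+v≡n) (cong suc v≡0)) n≥3)
                λ where (s≤s ())

-- a is the size of a smallest label class, c the number of labels that never sit next to
-- that class on the common labelling of the cycle.
record ClassBounds (k n p : ℕ) : Set where
  field
    a c     : ℕ
    a≥1     : 1 ≤ a
    p*a≤n   : p * a ≤ n
    p≤2a+c  : p ≤ 2 * a + c
    2k+ca≤n : 2 * k + c * a ≤ n

module SmallestLabelClass {k n p : ℕ} (P : LabeledPacking k n p) (n≥3 : 3 ≤ n) (i₀ : Fin k) where

  open LabeledPacking P

  classSize : Fin p → ℕ
  classSize = count ∘ fibre label

  smallest : Fin p
  smallest = argmin classSize (label (fromℕ< (≤-trans (s≤s z≤n) n≥3))) (allFin p)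

  smallest-minimal : ∀ m → classSize smallest ≤ classSize m
  smallest-minimal m = All.lookup (f[argmin]≤f[xs] _ (allFin p)) (∈-allFin m)

  cycleLabel : Fin n → Fin p
  cycleLabel v = label (σ i₀ v)

  next prev : Fin n → Fin n
  next = proj₁ ∘ cycle-successor
  prev = proj₁ ∘ cycle-predecessor

  next-edge : ∀ u → CEdge n u (next u)
  next-edge = proj₂ ∘ cycle-successor

  prev-edge : ∀ u → CEdge n (prev u) u
  prev-edge = proj₂ ∘ cycle-predecessor

  inSmallest : Fin n → Bool
  inSmallest = fibre cycleLabel smallest

  adjacent : Fin p → Bool
  adjacent m = image inSmallest (cycleLabel ∘ next) m ∨ image inSmallest (cycleLabel ∘ prev) m

  count-adjacent : count adjacent ≤ 2 * classSize smallest
  count-adjacent = begin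
    count adjacent                     ≤⟨ count-∨ (image inSmallest (cycleLabel ∘ next)) _ ⟩
    count (image inSmallest (cycleLabel ∘ next)) + count (image inSmallest (cycleLabel ∘ prev))
                                       ≤⟨ +-mono-≤ (image-bound next) (image-bound prev) ⟩
    a + a                              ≡⟨ cong (a +_) (+-identityʳ a) ⟨
    2 * a                              ∎
    where
    open ≤-Reasoning
    a = classSize smallest
    image-bound : (nb : Fin n → Fin n) → count (image inSmallest (cycleLabel ∘ nb)) ≤ a
    image-bound nb = ≤-trans (count-image inSmallest (cycleLabel ∘ nb))
                             (count-∘-injective (fibre label smallest) (σ i₀) (σ-inj i₀))

  shared-edge⇒same-copy : ∀ {i j a b c d} → CEdge n a b → CEdge n c d →
                          SamePair (σ i a) (σ i b) (σ j c) (σ j d) → i ≡ j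
  shared-edge⇒same-copy {i} {j} ab cd same with i ≟ j
  ... | yes i≡j = i≡j
  ... | no  i≢j = contradiction same (disjoint i j i≢j _ _ _ _ ab cd)

  w : Fin n
  w = proj₁ (label-onto smallest)

  position : Fin k → Fin n
  position i = proj₁ (injective⇒surjective (σ-inj i) w)

  position-spec : ∀ i → σ i (position i) ≡ w
  position-spec i = proj₂ (injective⇒surjective (σ-inj i) w)

  w-shared : ∀ i j → σ i (position i) ≡ σ j (position j)
  w-shared i j = trans (position-spec i) (sym (position-spec j))

  position-smallest : ∀ i → T (inSmallest (position i))
  position-smallest i = fibre⁺ cycleLabel (begin
    label (σ i₀ (position i))  ≡⟨ labels i₀ i (position i) ⟩
    label (σ i (position i))   ≡⟨ cong label (position-spec i) ⟩
    label w                    ≡⟨ proj₂ (label-onto smallest) ⟩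
    smallest                   ∎)
    where open ≡-Reasoning

  neighbour : Fin k ⊎ Fin k → Fin n
  neighbour (inj₁ i) = σ i (next (position i))
  neighbour (inj₂ i) = σ i (prev (position i))

  next≢prev : ∀ u → next u ≢ prev u
  next≢prev u next≡prev =
    CEdge-asym n≥3 (next-edge u) (subst (λ v → CEdge n v u) (sym next≡prev) (prev-edge u))

  neighbour-injective : Injective _≡_ _≡_ neighbour
  neighbour-injective {inj₁ i} {inj₁ j} eq =
    cong inj₁ (shared-edge⇒same-copy (next-edge _) (next-edge _) (inj₁ (w-shared i j , eq)))
  neighbour-injective {inj₂ i} {inj₂ j} eq =
    cong inj₂ (shared-edge⇒same-copy (prev-edge _) (prev-edge _) (inj₁ (eq , w-shared i j)))
  neighbour-injective {inj₁ i} {inj₂ j} eq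
    with refl ← shared-edge⇒same-copy (next-edge _) (prev-edge _) (inj₂ (w-shared i j , eq))
    = contradiction (σ-inj i eq) (next≢prev (position i))
  neighbour-injective {inj₂ i} {inj₁ j} eq
    with refl ← shared-edge⇒same-copy (prev-edge _) (next-edge _) (inj₂ (eq , w-shared i j))
    = contradiction (σ-inj i (sym eq)) (next≢prev (position i))

  neighbour-adjacent : ∀ s → T (adjacent (label (neighbour s)))
  neighbour-adjacent (inj₁ i) = subst (T ∘ adjacent) (labels i₀ i (next (position i)))
    (Equivalence.from T-∨ (inj₁ (image⁺ inSmallest (cycleLabel ∘ next) (position-smallest i))))
  neighbour-adjacent (inj₂ i) = subst (T ∘ adjacent) (labels i₀ i (prev (position i)))
    (Equivalence.from T-∨ (inj₂ (image⁺ inSmallest (cycleLabel ∘ prev) (position-smallest i))))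

  count-adjacent-labelled : k + k ≤ count (adjacent ∘ label)
  count-adjacent-labelled = injective⇒≤count (adjacent ∘ label) (neighbour ∘ splitAt k)
    (splitAt-injective k ∘ neighbour-injective) (neighbour-adjacent ∘ splitAt k)

  bounds : ClassBounds k n p
  bounds = record
    { a       = a
    ; c       = c
    ; a≥1     = count>0 (fibre label smallest) w (fibre⁺ label (proj₂ (label-onto smallest)))
    ; p*a≤n   = subst₂ (λ p′ n′ → p′ * a ≤ n′) (count-true p) (count-true n)
                       (count-preimage-≥ label (λ _ → true) smallest-minimal)
    ; p≤2a+c  = begin
        p                                         ≡⟨ count-complement adjacent ⟨
        count adjacent + c                        ≤⟨ +-monoˡ-≤ c count-adjacent ⟩
        2 * a + c                                 ∎
    ; 2k+ca≤n = begin
        2 * k + c * a                             ≡⟨ cong (λ m → k + m + c * a) (+-identityʳ k) ⟩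
        k + k + c * a                             ≤⟨ +-mono-≤ count-adjacent-labelled
                                                       (count-preimage-≥ label (not ∘ adjacent) smallest-minimal) ⟩
        count (adjacent ∘ label) + count (not ∘ adjacent ∘ label) ≡⟨ count-complement (adjacent ∘ label) ⟩
        n                                         ∎
    }
    where
    open ≤-Reasoning
    a = classSize smallest
    c = count (not ∘ adjacent)

labels≤-of-small-class : ∀ {a c p x} → 1 ≤ a → 2 * a ≤ x → c * a ≤ x → p ≤ 2 * a + c → p ≤ x + 2
labels≤-of-small-class {a} {c} {p} a≥1 2a≤x ca≤x p≤2a+c
  with e , refl ← m≤n⇒∃[o]m+o≡n 2a≤x = begin
    p                ≤⟨ p≤2a+c ⟩
    2 * a + c        ≤⟨ +-monoʳ-≤ (2 * a) (s≤s⁻¹ c<e+3) ⟩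
    2 * a + (e + 2)  ≡⟨ +-assoc (2 * a) e 2 ⟨
    2 * a + e + 2    ∎
  where
  open ≤-Reasoning
  c<e+3 : c < suc (e + 2)
  c<e+3 = *-cancelʳ-< a c (suc (e + 2)) (begin-strict
    c * a            ≤⟨ ca≤x ⟩
    2 * a + e        <⟨ +-monoˡ-≤ e (+-monoˡ-≤ (2 * a) a≥1) ⟩
    3 * a + e        ≡⟨ cong (3 * a +_) (*-identityʳ e) ⟨
    3 * a + e * 1    ≤⟨ +-monoʳ-≤ (3 * a) (*-monoʳ-≤ e a≥1) ⟩
    3 * a + e * a    ≡⟨ solve (a ∷ e ∷ []) ⟩
    suc (e + 2) * a  ∎)

labels≤-of-large-class : ∀ {a p x n} → x < 2 * a → p * a ≤ n → 2 * n ≤ x * x + 2 * x + 2 → p ≤ x + 2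
labels≤-of-large-class {a} {p} {x} {n} x<2a pa≤n 2n≤x²+2x+2 =
  s≤s⁻¹ (*-cancelʳ-< (suc x) p (suc (x + 2)) (begin-strict
    p * suc x                        ≤⟨ *-monoʳ-≤ p x<2a ⟩
    p * (2 * a)                      ≡⟨ solve (p ∷ a ∷ []) ⟩
    2 * (p * a)                      ≤⟨ *-monoʳ-≤ 2 pa≤n ⟩
    2 * n                            ≤⟨ 2n≤x²+2x+2 ⟩
    x * x + 2 * x + 2                <⟨ m<m+n _ z<s ⟩
    x * x + 2 * x + 2 + suc (2 * x)  ≡⟨ solve (x ∷ []) ⟩
    suc (x + 2) * suc x              ∎))
  where open ≤-Reasoning

twice-cycle-length≤ : ∀ k x → 4 * k ∸ 2 ≤ x * x → 2 * (2 * k + x) ≤ x * x + 2 * x + 2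
twice-cycle-length≤ k x 4k∸2≤x² = begin
  2 * (2 * k + x)          ≡⟨ solve (k ∷ x ∷ []) ⟩
  4 * k + 2 * x            ≤⟨ +-monoˡ-≤ (2 * x) (m≤n+m∸n (4 * k) 2) ⟩
  2 + (4 * k ∸ 2) + 2 * x  ≤⟨ +-monoˡ-≤ (2 * x) (+-monoʳ-≤ 2 4k∸2≤x²) ⟩
  2 + x * x + 2 * x        ≡⟨ solve (x ∷ []) ⟩
  x * x + 2 * x + 2        ∎
  where open ≤-Reasoning

mainTheorem4 : (k x : ℕ) → 2 ≤ k → 1 ≤ x → x ≤ 2 * k ∸ 1 →
    4 * k ∸ 2 ≤ x * x →
    (p : ℕ) → LabeledPacking k (2 * k + x) p → p ≤ x + 2
-- The bounds 1 ≤ x ≤ 2k − 1 only delimit the range of n; the argument does not use them.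
mainTheorem4 k x k≥2 _ _ 4k∸2≤x² p P =
  [ (λ 2a≤x → labels≤-of-small-class a≥1 2a≤x ca≤x p≤2a+c)
  , (λ x<2a → labels≤-of-large-class x<2a p*a≤n (twice-cycle-length≤ k x 4k∸2≤x²))
  ]′ (≤-<-connex (2 * a) x)
  where
  n≥3 : 3 ≤ 2 * k + x
  n≥3 = ≤-trans (m≤n⇒m≤1+n ≤-refl) (≤-trans (*-monoʳ-≤ 2 k≥2) (m≤m+n (2 * k) x))
  open ClassBounds (SmallestLabelClass.bounds P n≥3 (fromℕ< k≥2))
  ca≤x : c * a ≤ x
  ca≤x = +-cancelˡ-≤ (2 * k) (c * a) x 2k+ca≤n
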